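{- Let $L:\mathcal U$ be a $\mathcal V$-sup-lattice with basis $\beta:B\to L$, and let $f:L\to L$ be a monotone endomap. Then there is a local generator $\phi:\mathcal P_{\mathcal U\sqcup\mathcal V^+}(B\times L)$ with $\Gamma_\phi(x)=f(x)$ for all $x:L$.
   Context: We work in Martin-Löf type theory with non-cumulative universes (successor $\mathcal V^+$, join $\sqcup$), function extensionality, propositional extensionality and propositional truncations ($\exists$); no propositional resizing. A type is $\mathcal V$-small if equivalent to a type in $\mathcal V$. $\mathcal P_{\mathcal T}(X):=X\to\Omega_{\mathcal T}$ (propositions in $\mathcal T$). A poset: type $P:\mathcal U$ with proposition-valued reflexive antisymmetric transitive $\le:P\to P\to\mathcal W$; $f$ monotone if $x\le y\to f(x)\le f(y)$. A $\mathcal V$-sup-lattice: poset $L:\mathcal U$ where every family indexed by a type in $\mathcal V$ has a join $\bigvee$. A basis: $B:\mathcal V$, $\beta:B\to L$ with (1) each $\beta(b)\le x$ $\mathcal V$-small, (2) each $x$ is the join of $\beta\circ\mathrm{pr}_1$ on $\sum_b\beta(b)\le x$. A generator is $\phi:\mathcal P_{\mathcal U\sqcup\mathcal V^+}(B\times L)$; $S_{\phi,a}:=\sum_{b:B}\exists a':L,(b,a')\in\phi\wedge a'\le a$; $\phi$ is local if every $S_{\phi,a}$ is $\mathcal V$-small, and then $\Gamma_\phi(a):=\bigvee S_{\phi,a}$, the join of $\beta\circ\mathrm{pr}_1:S_{\phi,a}\to L$ (which exists by reindexing along an equivalence with a type in $\mathcal V$). -}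

module Defs where

open import Level using (Level; _⊔_; suc; Setω)
open import Data.Product using (Σ; Σ-syntax; _×_; _,_; proj₁; proj₂)
open import Relation.Binary.PropositionalEquality using (_≡_)

isProp : ∀ {ℓ} → Set ℓ → Set ℓ
isProp A = (x y : A) → x ≡ y

Ω : (𝓣 : Level) → Set (suc 𝓣)
Ω 𝓣 = Σ[ P ∈ Set 𝓣 ] isProp P

_holds : ∀ {𝓣} → Ω 𝓣 → Set 𝓣
(P , _) holds = P

𝓟 : ∀ {ℓ} (𝓣 : Level) → Set ℓ → Set (ℓ ⊔ suc 𝓣)
𝓟 𝓣 X = X → Ω 𝓣

Funext : Setω
Funext = ∀ {a b} {A : Set a} {B : A → Set b} {f g : (x : A) → B x}
       → ((x : A) → f x ≡ g x) → f ≡ g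

Propext : Setω
Propext = ∀ {ℓ} {P Q : Set ℓ} → isProp P → isProp Q → (P → Q) → (Q → P) → P ≡ Q

record PropTrunc : Setω where
  field
    ∥_∥      : ∀ {ℓ} → Set ℓ → Set ℓ
    ∥∥-isProp : ∀ {ℓ} {A : Set ℓ} → isProp ∥ A ∥
    ∣_∣      : ∀ {ℓ} {A : Set ℓ} → A → ∥ A ∥
    ∥∥-rec   : ∀ {ℓ ℓ'} {A : Set ℓ} {P : Set ℓ'} → isProp P → (A → P) → ∥ A ∥ → P

isEquiv : ∀ {a b} {A : Set a} {B : Set b} → (A → B) → Set (a ⊔ b)
isEquiv {A = A} {B} f =
  (Σ[ g ∈ (B → A) ] ((y : B) → f (g y) ≡ y)) × (Σ[ h ∈ (B → A) ] ((x : A) → h (f x) ≡ x))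

_≃_ : ∀ {a b} → Set a → Set b → Set (a ⊔ b)
A ≃ B = Σ[ e ∈ (A → B) ] isEquiv e

isSmall : ∀ {ℓ} (𝓥 : Level) → Set ℓ → Set (ℓ ⊔ suc 𝓥)
isSmall 𝓥 X = Σ[ Y ∈ Set 𝓥 ] (Y ≃ X)

record SupLattice (𝓤 𝓦 𝓥 : Level) : Set (suc 𝓤 ⊔ suc 𝓦 ⊔ suc 𝓥) where
  field
    Carrier   : Set 𝓤
    _≤_       : Carrier → Carrier → Set 𝓦
    ≤-isProp  : (x y : Carrier) → isProp (x ≤ y)
    ≤-refl    : (x : Carrier) → x ≤ x
    ≤-antisym : {x y : Carrier} → x ≤ y → y ≤ x → x ≡ y
    ≤-trans   : {x y z : Carrier} → x ≤ y → y ≤ z → x ≤ z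
    ⋁         : {I : Set 𝓥} → (I → Carrier) → Carrier
    ⋁-upper   : {I : Set 𝓥} (α : I → Carrier) (i : I) → α i ≤ ⋁ α
    ⋁-least   : {I : Set 𝓥} (α : I → Carrier) (u : Carrier)
              → ((i : I) → α i ≤ u) → ⋁ α ≤ u

  isLUB : ∀ {ℓ} {I : Set ℓ} → (I → Carrier) → Carrier → Set (ℓ ⊔ 𝓤 ⊔ 𝓦)
  isLUB {I = I} α x = ((i : I) → α i ≤ x) × ((u : Carrier) → ((i : I) → α i ≤ u) → x ≤ u)

  isMonotone : (Carrier → Carrier) → Set (𝓤 ⊔ 𝓦)
  isMonotone f = {x y : Carrier} → x ≤ y → f x ≤ f y

record Basis {𝓤 𝓦 𝓥 : Level} (L : SupLattice 𝓤 𝓦 𝓥) : Set (𝓤 ⊔ 𝓦 ⊔ suc 𝓥) where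
  open SupLattice L
  field
    B        : Set 𝓥
    β        : B → Carrier
    ≤-small  : (b : B) (x : Carrier) → isSmall 𝓥 (β b ≤ x)
    is-join  : (x : Carrier) → isLUB {I = Σ[ b ∈ B ] (β b ≤ x)} (λ p → β (proj₁ p)) x

module WithTrunc (pt : PropTrunc) where
  open PropTrunc pt

  ∃ : ∀ {a b} (A : Set a) → (A → Set b) → Set (a ⊔ b)
  ∃ A P = ∥ Σ A P ∥

  module _ {𝓤 𝓦 𝓥 : Level} {L : SupLattice 𝓤 𝓦 𝓥} (𝔅 : Basis L) where
    open SupLattice L
    open Basis 𝔅

    Generator : Set (𝓤 ⊔ suc (𝓤 ⊔ suc 𝓥))
    Generator = 𝓟 (𝓤 ⊔ suc 𝓥) (B × Carrier)

    S : Generator → Carrier → Set (𝓤 ⊔ 𝓦 ⊔ suc 𝓥)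
    S φ a = Σ[ b ∈ B ] ∃ Carrier (λ a' → ((φ (b , a')) holds) × (a' ≤ a))

    isLocal : Generator → Set (𝓤 ⊔ 𝓦 ⊔ suc 𝓥)
    isLocal φ = (a : Carrier) → isSmall 𝓥 (S φ a)

    -- Γ_φ(a) := join of β ∘ pr₁ on S_{φ,a}, reindexed along the small copy
    Γ : (φ : Generator) → isLocal φ → Carrier → Carrier
    Γ φ loc a = ⋁ {I = proj₁ (loc a)} (λ y → β (proj₁ (proj₁ (proj₂ (loc a)) y)))

-- Take φ(b, a') := ∥ β b ≤ f a' ∥ (via the small copy of β b ≤ f a'). By monotonicity of f,
-- b ∈ S_{φ,a} iff β b ≤ f a, so S_{φ,a} is equivalent to the small type Σ b, ∥ β b ≤ f a ∥,
-- and Γ_φ(a) is the join of the basis elements below f a, which is f a.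
module Submission where

open import Defs
open import Level using (Level; _⊔_; Lift; lift; lower)
open import Function using (_∘_)
open import Data.Product using (Σ; Σ-syntax; _,_; proj₁; proj₂)
open import Relation.Binary.PropositionalEquality using (_≡_; refl; sym; cong)

liftΩ : ∀ {ℓ} ℓ' → Ω ℓ → Ω (ℓ ⊔ ℓ')
liftΩ ℓ' (P , P-isProp) = Lift ℓ' P , λ p q → cong lift (P-isProp (lower p) (lower q))

Σ-cong-prop : ∀ {a p q} {A : Set a} {P : A → Set p} {Q : A → Set q}
            → (∀ x → isProp (P x)) → (∀ x → isProp (Q x))
            → (∀ {x} → P x → Q x) → (∀ {x} → Q x → P x)
            → Σ A P ≃ Σ A Q
Σ-cong-prop P-isProp Q-isProp to from =
  (λ { (x , p) → x , to p })
  , ((λ { (x , q) → x , from q }) , λ { (x , q) → cong (x ,_) (Q-isProp x _ q) })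
  , ((λ { (x , q) → x , from q }) , λ { (x , p) → cong (x ,_) (P-isProp x _ p) })

module LeastUpperBounds {𝓤 𝓦 𝓥 : Level} (L : SupLattice 𝓤 𝓦 𝓥) where
  open SupLattice L

  ≤-reflexive : {x y : Carrier} → x ≡ y → x ≤ y
  ≤-reflexive {x} refl = ≤-refl x

  ⋁-isLUB : {I : Set 𝓥} (α : I → Carrier) → isLUB α (⋁ α)
  ⋁-isLUB α = ⋁-upper α , ⋁-least α

  isLUB-unique : ∀ {ℓ} {I : Set ℓ} {α : I → Carrier} {x y : Carrier}
               → isLUB α x → isLUB α y → x ≡ y
  isLUB-unique (x-upper , x-least) (y-upper , y-least) =
    ≤-antisym (x-least _ y-upper) (y-least _ x-upper)

  _≲_ : ∀ {ℓ ℓ'} {I : Set ℓ} {J : Set ℓ'} → (I → Carrier) → (J → Carrier) → Set (ℓ ⊔ ℓ' ⊔ 𝓦)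
  _≲_ {I = I} {J} α γ = (i : I) → Σ[ j ∈ J ] (α i ≤ γ j)

  isLUB-transfer : ∀ {ℓ ℓ'} {I : Set ℓ} {J : Set ℓ'} {α : I → Carrier} {γ : J → Carrier}
                 {x : Carrier} → α ≲ γ → γ ≲ α → isLUB α x → isLUB γ x
  isLUB-transfer α≲γ γ≲α (x-upper , x-least) =
      (λ j → let (i , γj≤αi) = γ≲α j in ≤-trans γj≤αi (x-upper i))
    , (λ u γ≤u → x-least u λ i → let (j , αi≤γj) = α≲γ i in ≤-trans αi≤γj (γ≤u j))

  isLUB-reindex : ∀ {ℓ ℓ'} {I : Set ℓ} {J : Set ℓ'} {α : I → Carrier} {x : Carrier}
                → ((e , _) : J ≃ I) → isLUB (α ∘ e) x → isLUB α x
  isLUB-reindex {α = α} (e , (s , e∘s) , _) =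
    isLUB-transfer (λ j → e j , ≤-refl _) (λ i → s i , ≤-reflexive (cong α (sym (e∘s i))))

module _ (pt : PropTrunc) {𝓤 𝓦 𝓥 : Level} {L : SupLattice 𝓤 𝓦 𝓥} (𝔅 : Basis L) where
  open PropTrunc pt
  open SupLattice L
  open Basis 𝔅
  open WithTrunc pt
  open LeastUpperBounds L

  Γ-isLUB : (φ : Generator 𝔅) (loc : isLocal 𝔅 φ) (a : Carrier)
          → isLUB {I = S 𝔅 φ a} (β ∘ proj₁) (Γ 𝔅 φ loc a)
  Γ-isLUB φ loc a = isLUB-reindex (proj₂ (loc a)) (⋁-isLUB _)

  _≤ᴮ_ : B → Carrier → Set 𝓥
  b ≤ᴮ x = proj₁ (≤-small b x)

  ≤ᴮ⇒≤ : ∀ {b x} → b ≤ᴮ x → β b ≤ x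
  ≤ᴮ⇒≤ {b} {x} = proj₁ (proj₂ (≤-small b x))

  ≤⇒≤ᴮ : ∀ {b x} → β b ≤ x → b ≤ᴮ x
  ≤⇒≤ᴮ {b} {x} = proj₁ (proj₁ (proj₂ (proj₂ (≤-small b x))))

  ∥≤ᴮ∥⇒≤ : ∀ {b x} → ∥ b ≤ᴮ x ∥ → β b ≤ x
  ∥≤ᴮ∥⇒≤ = ∥∥-rec (≤-isProp _ _) ≤ᴮ⇒≤

  module _ (f : Carrier → Carrier) (f-mono : isMonotone f) where

    generatorOf : Generator 𝔅
    generatorOf (b , a') = liftΩ (𝓤 ⊔ Level.suc 𝓥) (∥ b ≤ᴮ f a' ∥ , ∥∥-isProp)

    S-generatorOf⇒≤ : ∀ {a} ((b , _) : S 𝔅 generatorOf a) → β b ≤ f a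
    S-generatorOf⇒≤ (b , t) =
      ∥∥-rec (≤-isProp _ _) (λ { (a' , lift u , a'≤a) → ≤-trans (∥≤ᴮ∥⇒≤ u) (f-mono a'≤a) }) t

    ≤⇒S-generatorOf : ∀ {a b} → β b ≤ f a → S 𝔅 generatorOf a
    ≤⇒S-generatorOf {a} {b} βb≤fa = b , ∣ a , lift ∣ ≤⇒≤ᴮ βb≤fa ∣ , ≤-refl a ∣

    generatorOf-isLocal : isLocal 𝔅 generatorOf
    generatorOf-isLocal a =
        (Σ[ b ∈ B ] ∥ b ≤ᴮ f a ∥)
      , Σ-cong-prop (λ _ → ∥∥-isProp) (λ _ → ∥∥-isProp)
          (proj₂ ∘ ≤⇒S-generatorOf ∘ ∥≤ᴮ∥⇒≤)
          (λ {b} t → ∣ ≤⇒≤ᴮ (S-generatorOf⇒≤ (b , t)) ∣)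

    Γ-generatorOf : (x : Carrier) → Γ 𝔅 generatorOf generatorOf-isLocal x ≡ f x
    Γ-generatorOf x = isLUB-unique (Γ-isLUB generatorOf generatorOf-isLocal x)
      (isLUB-transfer (λ { (b , βb≤fx) → ≤⇒S-generatorOf βb≤fx , ≤-refl _ })
                      (λ s → (proj₁ s , S-generatorOf⇒≤ s) , ≤-refl _)
                      (is-join (f x)))

proposition6p6 : (pt : PropTrunc) → Funext → Propext
    → {𝓤 𝓦 𝓥 : Level} (L : SupLattice 𝓤 𝓦 𝓥) (𝔅 : Basis L)
    → (f : SupLattice.Carrier L → SupLattice.Carrier L)
    → SupLattice.isMonotone L f
    → Σ[ φ ∈ WithTrunc.Generator pt 𝔅 ]
        Σ[ loc ∈ WithTrunc.isLocal pt 𝔅 φ ]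
          ((x : SupLattice.Carrier L) → WithTrunc.Γ pt 𝔅 φ loc x ≡ f x)
proposition6p6 pt _ _ L 𝔅 f f-mono =
    generatorOf pt 𝔅 f f-mono
  , generatorOf-isLocal pt 𝔅 f f-mono
  , Γ-generatorOf pt 𝔅 f f-mono
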